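{- Let $g = g(y_1,\ldots,y_n)$ be a positive threshold Boolean function and let $\{y_{i_1},\ldots,y_{i_k}\}$ be a set of (distinct) relevant variables of $g$. For each $j\in[k]$ fix a $y_{i_j}$-extremal pair $(a_{i_j}, b_{i_j})$ for $g$, and let $H$ be the undirected graph with vertex set $\{a_{i_j}, b_{i_j} : j\in[k]\}$ and edge set $\{\{a_{i_j}, b_{i_j}\} : j \in [k]\}$. Then $H$ is acyclic.
   Context: $B=\{0,1\}$; for $x,y\in B^n$, $x\preceq y$ means $(x)_i=1$ implies $(y)_i=1$. $g$ is positive if $g(x)=1$ and $x\preceq y$ imply $g(y)=1$; $g$ is threshold if there are reals $w_1,\dots,w_n,t$ with $g(x)=0\iff\sum_i w_ix_i\le t$. A variable $y_i$ is relevant for $g$ if fixing $y_i=1$ and $y_i=0$ gives different functions. A maximal zero of $g$ is a $\preceq$-maximal point with $g=0$; a minimal one is a $\preceq$-minimal point with $g=1$. A maximal zero $a$ corresponds to $y_i$ if $(a)_i=0$; a minimal one $b$ corresponds to $y_i$ if $(b)_i=1$. A pair $(a,b)$ of points of $B^n$ is $y_i$-extremal for $g$ if $a$ is a maximal zero of $g$ corresponding to $y_i$, $b$ is a minimal one of $g$ corresponding to $y_i$, and $(a)_j\ge(b)_j$ for every $j\in[n]\setminus\{i\}$.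
   Formalization: The threshold weights $w_1,\dots,w_n$ and the threshold t are rational rather than real. -}

module Defs where

open import Data.Bool using (Bool; true; false; if_then_else_)
open import Data.Nat using (ℕ; suc)
open import Data.Fin using (Fin; zero; suc; inject₁; fromℕ)
open import Data.Vec using (Vec; lookup; _[_]≔_; zipWith; foldr)
open import Data.Rational using (ℚ; 0ℚ; _+_; _≤_)
open import Data.Product using (Σ; _×_; ∃; ∃-syntax)
open import Data.Sum using (_⊎_)
open import Data.Empty using (⊥)
open import Relation.Nullary using (¬_)
open import Relation.Binary.PropositionalEquality using (_≡_; _≢_)
open import Function.Bundles using (_⇔_)
open import Function.Definitions using (Injective)

Point : ℕ → Set
Point n = Vec Bool n

BoolFun : ℕ → Set
BoolFun n = Point n → Bool

_≼_ : ∀ {n} → Point n → Point n → Set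
x ≼ y = ∀ i → lookup x i ≡ true → lookup y i ≡ true

Positive : ∀ {n} → BoolFun n → Set
Positive g = ∀ x y → g x ≡ true → x ≼ y → g y ≡ true

wsum : ∀ {n} → Vec ℚ n → Point n → ℚ
wsum w x = foldr _ _+_ 0ℚ (zipWith (λ wi xi → if xi then wi else 0ℚ) w x)

Threshold : ∀ {n} → BoolFun n → Set
Threshold {n} g = Σ (Vec ℚ n) λ w → Σ ℚ λ t → ∀ x → (g x ≡ false) ⇔ (wsum w x ≤ t)

Relevant : ∀ {n} → BoolFun n → Fin n → Set
Relevant g i = ¬ (∀ x → g (x [ i ]≔ true) ≡ g (x [ i ]≔ false))

MaximalZero : ∀ {n} → BoolFun n → Point n → Set
MaximalZero g a = g a ≡ false × (∀ y → a ≼ y → g y ≡ false → y ≡ a)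

MinimalOne : ∀ {n} → BoolFun n → Point n → Set
MinimalOne g b = g b ≡ true × (∀ y → y ≼ b → g y ≡ true → y ≡ b)

Extremal : ∀ {n} → BoolFun n → Fin n → Point n → Point n → Set
Extremal g i a b =
  MaximalZero g a × lookup a i ≡ false ×
  MinimalOne g b × lookup b i ≡ true ×
  (∀ j → j ≢ i → lookup b j ≡ true → lookup a j ≡ true)

Adj : ∀ {n k} → (Fin k → Point n) → (Fin k → Point n) → Point n → Point n → Set
Adj a b u v = ∃[ j ] ((u ≡ a j × v ≡ b j) ⊎ (u ≡ b j × v ≡ a j))

-- A cycle: m+3 pairwise distinct vertices c 0, …, c (m+2), consecutive ones
-- adjacent, and c (m+2) adjacent to c 0.
Acyclic : ∀ {n k} → (Fin k → Point n) → (Fin k → Point n) → Set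
Acyclic {n} a b = ∀ m (c : Fin (suc (suc (suc m))) → Point n) →
  Injective _≡_ _≡_ c →
  (∀ (i : Fin (suc (suc m))) → Adj a b (c (inject₁ i)) (c (suc i))) →
  Adj a b (c (fromℕ (suc (suc m)))) (c zero) → ⊥

{-# OPTIONS --safe #-}
module Submission where

-- Suppose H contains a cycle. Its vertices alternate between maximal zeros and minimal ones
-- of g, and distinct positions on the cycle carry distinct labels j. Let N be the set of
-- coordinates of negative weight; every maximal zero contains N, and b ∨ N is still a one of
-- g. Summing over the edges of the cycle, w·a_j ≤ θ < w·(b_j ∨ N) gives
-- Σ w·a_j < Σ w·(b_j ∨ N). Coordinatewise the reverse inequality holds: on N both sides
-- count every edge, and on a coordinate l of nonnegative weight extremality gives
-- (b_j)_l ≤ (a_j)_l except on the at most one edge with idx j = l, so the number of edges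
-- with (b_j)_l = 1 exceeds the number with (a_j)_l = 1 by at most one. Both numbers are even,
-- since every vertex lies on exactly two edges of the cycle, so the excess is zero.

open import Defs
open import Algebra.Bundles using (Monoid; CommutativeMonoid)
import Algebra.Properties.CommutativeMonoid.Sum as CommutativeMonoidSum
import Algebra.Properties.CommutativeSemigroup as CommutativeSemigroupProperties
import Algebra.Properties.Monoid.Mult as MonoidMult
import Algebra.Properties.Monoid.Sum as MonoidSum
open import Data.Bool using (Bool; true; false; not; _∧_; _∨_; if_then_else_)
open import Data.Bool.Properties using (∨-zeroʳ; ∨-identityʳ)
open import Data.Empty using (⊥; ⊥-elim)
open import Data.Fin using (Fin; zero; suc; toℕ; fromℕ; inject₁; _≟_)
open import Data.Fin.Properties using (0≢1+n; suc-injective; toℕ-inject₁)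
open import Data.Fin.Relation.Unary.Top using (view; ‵fromℕ; ‵inj₁; view-fromℕ; view-inject₁)
open import Data.Nat using (ℕ; zero; suc; _+_; _≤_; z≤n; s≤s)
import Data.Nat.Properties as ℕ
open import Data.Product using (_,_; proj₁; proj₂)
open import Data.Rational as ℚ using (ℚ; 0ℚ)
import Data.Rational.Properties as ℚ
open import Data.Sum using (_⊎_; inj₁; inj₂)
open import Data.Vec using (Vec; []; _∷_; lookup; tabulate; _[_]≔_)
open import Data.Vec.Properties using (lookup∘update; lookup∘update′; lookup∘tabulate)
open import Data.Vec.Functional using (Vector)
open import Function using (_∘_; _⇔_; Equivalence)
open import Function.Definitions using (Injective)
open import Relation.Binary using (Rel; _Preserves₂_⟶_⟶_)
open import Relation.Binary.PropositionalEquality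
  using (_≡_; _≢_; refl; sym; trans; cong; cong₂; subst; subst₂; ≢-sym; module ≡-Reasoning)
open import Relation.Nullary using (¬_; yes; no; does; contradiction)
open import Relation.Nullary.Decidable using (dec-true; dec-false)

𝟙 : Bool → ℕ
𝟙 true = 1
𝟙 false = 0

𝟙≤1 : ∀ x → 𝟙 x ≤ 1
𝟙≤1 true = ℕ.≤-refl
𝟙≤1 false = z≤n

𝟙-mono : ∀ {x y} → (x ≡ true → y ≡ true) → 𝟙 x ≤ 𝟙 y
𝟙-mono {false} _ = z≤n
𝟙-mono {true} x⇒y rewrite x⇒y refl = ℕ.≤-refl

m+m≤1+n+n⇒m≤n : ∀ {m n} → m + m ≤ suc (n + n) → m ≤ n
m+m≤1+n+n⇒m≤n {m} {n} m+m≤1+n+n = ℕ.≮⇒≥ λ n<m → ℕ.1+n≰n (ℕ.≤-trans (begin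
  suc (suc (n + n)) ≡⟨ cong suc (ℕ.+-suc n n) ⟨
  suc n + suc n     ≤⟨ ℕ.+-mono-≤ n<m n<m ⟩
  m + m             ∎) m+m≤1+n+n)
  where open ℕ.≤-Reasoning

next : ∀ {n} → Fin (suc n) → Fin (suc n)
next i with view i
... | ‵fromℕ = zero
... | ‵inj₁ {i = j} _ = suc j

next-fromℕ : ∀ n → next (fromℕ n) ≡ zero
next-fromℕ n rewrite view-fromℕ n = refl

next-inject₁ : ∀ {n} (j : Fin n) → next (inject₁ j) ≡ suc j
next-inject₁ j rewrite view-inject₁ j = refl

next≡0⊎toℕ-next≡1+toℕ : ∀ {n} (i : Fin (suc n)) → next i ≡ zero ⊎ toℕ (next i) ≡ suc (toℕ i)
next≡0⊎toℕ-next≡1+toℕ i with view i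
... | ‵fromℕ = inj₁ refl
... | ‵inj₁ {i = j} _ = inj₂ (cong suc (sym (toℕ-inject₁ j)))

next∘next≢id : ∀ {m} (i : Fin (3 + m)) → next (next i) ≢ i
next∘next≢id i with view i
... | ‵fromℕ = λ ()
... | ‵inj₁ {i = j} _ = next-suc≢inject₁ j (next≡0⊎toℕ-next≡1+toℕ (suc j))
  where
    next-suc≢inject₁ : ∀ {m} (j : Fin (2 + m)) →
      next (suc j) ≡ zero ⊎ toℕ (next (suc j)) ≡ suc (suc (toℕ j)) → next (suc j) ≢ inject₁ j
    next-suc≢inject₁ zero (inj₁ ()) _
    next-suc≢inject₁ (suc j) (inj₁ next≡0) eq with () ← trans (sym next≡0) eq
    next-suc≢inject₁ j (inj₂ toℕ-next) eq =
      ℕ.m≢1+n+m (toℕ j) (trans (sym (toℕ-inject₁ j)) (trans (cong toℕ (sym eq)) toℕ-next))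

cyclically : ∀ {a r} {A : Set a} {R : A → A → Set r} {m} {c : Fin (suc m) → A} →
  (∀ i → R (c (inject₁ i)) (c (suc i))) → R (c (fromℕ m)) (c zero) → ∀ i → R (c i) (c (next i))
cyclically steps closing i with view i
... | ‵fromℕ = closing
... | ‵inj₁ {i = j} _ = steps j

module ℕ∑ = CommutativeMonoidSum ℕ.+-0-commutativeMonoid
module ℚ∑ = CommutativeMonoidSum ℚ.+-0-commutativeMonoid

∑ℕ : ∀ {n} → Vector ℕ n → ℕ
∑ℕ = ℕ∑.sum

∑ℚ : ∀ {n} → Vector ℚ n → ℚ
∑ℚ = ℚ∑.sum

module _ {c ℓ} (M : Monoid c ℓ) where
  open Monoid M renaming (refl to ≈-refl; sym to ≈-sym; trans to ≈-trans)
  open MonoidSum M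
  open MonoidMult M using (_×_; ×-homo-+)

  sum-preserves : ∀ {r} (_∼_ : Rel Carrier r) → ε ∼ ε → _∙_ Preserves₂ _∼_ ⟶ _∼_ ⟶ _∼_ →
    ∀ {n} {f h : Vector Carrier n} → (∀ i → f i ∼ h i) → sum f ∼ sum h
  sum-preserves _ ε∼ε _ {zero} _ = ε∼ε
  sum-preserves _∼_ ε∼ε ∙-pres {suc n} f∼h =
    ∙-pres (f∼h zero) (sum-preserves _∼_ ε∼ε ∙-pres (f∼h ∘ suc))

  sum-× : ∀ {n} (m : Vector ℕ n) x → sum (λ i → m i × x) ≈ ∑ℕ m × x
  sum-× {zero} m x = ≈-refl
  sum-× {suc n} m x = ≈-trans (∙-congˡ (sum-× (m ∘ suc) x)) (≈-sym (×-homo-+ x (m zero) _))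

module _ {c ℓ} (M : CommutativeMonoid c ℓ) where
  open CommutativeMonoid M hiding (refl; sym; trans)
  open CommutativeMonoidSum M
  open import Relation.Binary.Reasoning.Setoid setoid

  sum-next : ∀ {n} (f : Vector Carrier (suc n)) → sum (f ∘ next) ≈ sum f
  sum-next {n} f = begin
    sum (f ∘ next)                                ≈⟨ sum-init-last (f ∘ next) ⟩
    sum (f ∘ next ∘ inject₁) ∙ f (next (fromℕ n)) ≡⟨ cong₂ _∙_ (sum-cong-≗ (cong f ∘ next-inject₁))
                                                               (cong f (next-fromℕ n)) ⟩
    sum (f ∘ suc) ∙ f zero                        ≈⟨ comm _ _ ⟩
    f zero ∙ sum (f ∘ suc)                        ∎

open MonoidMult ℚ.+-0-monoid using (_×_; ×-homo-1)

∑ℕ-mono-≤ : ∀ {n} {f h : Vector ℕ n} → (∀ i → f i ≤ h i) → ∑ℕ f ≤ ∑ℕ h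
∑ℕ-mono-≤ = sum-preserves ℕ.+-0-monoid _≤_ z≤n ℕ.+-mono-≤

∑ℚ-mono-≤ : ∀ {n} {f h : Vector ℚ n} → (∀ i → f i ℚ.≤ h i) → ∑ℚ f ℚ.≤ ∑ℚ h
∑ℚ-mono-≤ = sum-preserves ℚ.+-0-monoid ℚ._≤_ ℚ.≤-refl ℚ.+-mono-≤

∑ℚ-mono-< : ∀ {n} {f h : Vector ℚ (suc n)} → (∀ i → f i ℚ.< h i) → ∑ℚ f ℚ.< ∑ℚ h
∑ℚ-mono-< f<h = ℚ.+-mono-<-≤ (f<h zero) (∑ℚ-mono-≤ (ℚ.<⇒≤ ∘ f<h ∘ suc))

∑𝟙-≟-≤1 : ∀ {m n} {f : Fin m → Fin n} → Injective _≡_ _≡_ f →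
  ∀ y → ∑ℕ (λ i → 𝟙 (does (f i ≟ y))) ≤ 1
∑𝟙-≟-≤1 {zero} _ _ = z≤n
∑𝟙-≟-≤1 {suc m} {f = f} f-injective y with f zero ≟ y
... | no _ = ∑𝟙-≟-≤1 (suc-injective ∘ f-injective) y
... | yes f0≡y =
  ℕ.≤-reflexive (cong suc (trans (ℕ∑.sum-cong-≗ rest≡0) (ℕ∑.sum-replicate-zero m)))
  where
    rest≡0 : ∀ i → 𝟙 (does (f (suc i) ≟ y)) ≡ 0
    rest≡0 i = cong 𝟙 (dec-false (f (suc i) ≟ y) λ fi≡y → 0≢1+n (f-injective (trans f0≡y (sym fi≡y))))

×-nonNeg : ∀ {q} → 0ℚ ℚ.≤ q → ∀ m → 0ℚ ℚ.≤ m × q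
×-nonNeg q≥0 zero = ℚ.≤-refl
×-nonNeg q≥0 (suc m) = ℚ.+-mono-≤ q≥0 (×-nonNeg q≥0 m)

×-monoˡ-≤ : ∀ {q} → 0ℚ ℚ.≤ q → ∀ {m m′} → m ≤ m′ → m × q ℚ.≤ m′ × q
×-monoˡ-≤ q≥0 {m′ = m′} z≤n = ×-nonNeg q≥0 m′
×-monoˡ-≤ {q} q≥0 (s≤s m≤m′) = ℚ.+-monoʳ-≤ q (×-monoˡ-≤ q≥0 m≤m′)

if-then-0≡𝟙× : ∀ b q → (if b then q else 0ℚ) ≡ 𝟙 b × q
if-then-0≡𝟙× true q = sym (×-homo-1 q)
if-then-0≡𝟙× false q = refl

count : ∀ {m n} → (Fin m → Point n) → Fin n → ℕ
count xs l = ∑ℕ (λ i → 𝟙 (lookup (xs i) l))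

wsum≡∑ : ∀ {n} (w : Vec ℚ n) x → wsum w x ≡ ∑ℚ (λ l → if lookup x l then lookup w l else 0ℚ)
wsum≡∑ [] [] = refl
wsum≡∑ (w₀ ∷ w) (x₀ ∷ x) = cong ((if x₀ then w₀ else 0ℚ) ℚ.+_) (wsum≡∑ w x)

∑-wsum≡∑-count× : ∀ {m n} (w : Vec ℚ n) (xs : Fin m → Point n) →
  ∑ℚ (λ i → wsum w (xs i)) ≡ ∑ℚ (λ l → count xs l × lookup w l)
∑-wsum≡∑-count× w xs = begin
  ∑ℚ (λ i → wsum w (xs i))               ≡⟨ ℚ∑.sum-cong-≗ (wsum≡∑ w ∘ xs) ⟩
  ∑ℚ (λ i → ∑ℚ (λ l → term i l))         ≡⟨ ℚ∑.∑-comm term ⟩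
  ∑ℚ (λ l → ∑ℚ (λ i → term i l))         ≡⟨ ℚ∑.sum-cong-≗ count× ⟩
  ∑ℚ (λ l → count xs l × lookup w l)     ∎
  where
    open ≡-Reasoning
    term : Fin _ → Fin _ → ℚ
    term i l = if lookup (xs i) l then lookup w l else 0ℚ
    count× : ∀ l → ∑ℚ (λ i → term i l) ≡ count xs l × lookup w l
    count× l = trans (ℚ∑.sum-cong-≗ λ i → if-then-0≡𝟙× (lookup (xs i) l) (lookup w l))
                     (sum-× ℚ.+-0-monoid (λ i → 𝟙 (lookup (xs i) l)) (lookup w l))

∑-wsum-mono-≤ : ∀ {m n} (w : Vec ℚ n) {xs ys : Fin m → Point n} →
  (∀ l → count xs l × lookup w l ℚ.≤ count ys l × lookup w l) →
  ∑ℚ (λ i → wsum w (xs i)) ℚ.≤ ∑ℚ (λ i → wsum w (ys i))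
∑-wsum-mono-≤ w {xs} {ys} coordinatewise =
  subst₂ ℚ._≤_ (sym (∑-wsum≡∑-count× w xs)) (sym (∑-wsum≡∑-count× w ys))
    (∑ℚ-mono-≤ coordinatewise)

wsum-[]≔true : ∀ {n} (w : Vec ℚ n) (x : Point n) l → lookup x l ≡ false →
  wsum w (x [ l ]≔ true) ≡ lookup w l ℚ.+ wsum w x
wsum-[]≔true (w₀ ∷ w) (false ∷ x) zero refl = cong (w₀ ℚ.+_) (sym (ℚ.+-identityˡ _))
wsum-[]≔true (w₀ ∷ w) (x₀ ∷ x) (suc l) x[l]≡false =
  trans (cong ((if x₀ then w₀ else 0ℚ) ℚ.+_) (wsum-[]≔true w x l x[l]≡false))
        (x∙yz≈y∙xz (if x₀ then w₀ else 0ℚ) (lookup w l) (wsum w x))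
  where
    open CommutativeSemigroupProperties
      (CommutativeMonoid.commutativeSemigroup ℚ.+-0-commutativeMonoid)

≼-[]≔true : ∀ {n} (x : Point n) l → x ≼ (x [ l ]≔ true)
≼-[]≔true x l i x[i] with i ≟ l
... | yes refl = lookup∘update i x true
... | no i≢l = trans (lookup∘update′ i≢l x true) x[i]

withNegatives : ∀ {n} → Vec ℚ n → Point n → Point n
withNegatives w x = tabulate (λ l → lookup x l ∨ does (lookup w l ℚ.<? 0ℚ))

≼-withNegatives : ∀ {n} (w : Vec ℚ n) x → x ≼ withNegatives w x
≼-withNegatives w x l x[l] = trans (lookup∘tabulate _ l) (cong (_∨ _) x[l])

module _ {n} (w : Vec ℚ n) (x : Point n) {l : Fin n} where

  withNegatives-negative : lookup w l ℚ.< 0ℚ → lookup (withNegatives w x) l ≡ true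
  withNegatives-negative w<0 = trans (lookup∘tabulate _ l)
    (trans (cong (lookup x l ∨_) (dec-true (lookup w l ℚ.<? 0ℚ) w<0)) (∨-zeroʳ _))

  withNegatives-nonNegative : ¬ lookup w l ℚ.< 0ℚ → lookup (withNegatives w x) l ≡ lookup x l
  withNegatives-nonNegative w≮0 = trans (lookup∘tabulate _ l)
    (trans (cong (lookup x l ∨_) (dec-false (lookup w l ℚ.<? 0ℚ) w≮0)) (∨-identityʳ _))

module ThresholdFunction {n} {g : BoolFun n} (w : Vec ℚ n) (θ : ℚ)
  (threshold : ∀ x → (g x ≡ false) ⇔ (wsum w x ℚ.≤ θ)) where

  maximalZero-negative : ∀ {a} → MaximalZero g a → ∀ {l} → lookup w l ℚ.< 0ℚ → lookup a l ≡ true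
  maximalZero-negative {a} (a-zero , a-maximal) {l} w<0 with lookup a l in a[l]
  ... | true = refl
  ... | false = contradiction (trans (sym a[l]) (trans (cong (λ x → lookup x l) (sym a⁺≡a))
                                                       (lookup∘update l a true))) λ ()
    where
      open ℚ.≤-Reasoning
      a⁺ : Point n
      a⁺ = a [ l ]≔ true
      a⁺≡a : a⁺ ≡ a
      a⁺≡a = a-maximal a⁺ (≼-[]≔true a l) (Equivalence.from (threshold a⁺) (begin
        wsum w a⁺                ≡⟨ wsum-[]≔true w a l a[l] ⟩
        lookup w l ℚ.+ wsum w a  ≤⟨ ℚ.+-monoˡ-≤ (wsum w a) (ℚ.<⇒≤ w<0) ⟩
        0ℚ ℚ.+ wsum w a          ≡⟨ ℚ.+-identityˡ (wsum w a) ⟩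
        wsum w a                 ≤⟨ Equivalence.to (threshold a) a-zero ⟩
        θ                        ∎))

  count×-withNegatives≤ : ∀ {m} {as bs : Fin m → Point n} → (∀ i → MaximalZero g (as i)) → ∀ l →
    count bs l ≤ count as l →
    count (withNegatives w ∘ bs) l × lookup w l ℚ.≤ count as l × lookup w l
  count×-withNegatives≤ {as = as} {bs} as-maximal l count-bs≤count-as with lookup w l ℚ.<? 0ℚ
  ... | yes w<0 = ℚ.≤-reflexive (cong (_× lookup w l) (ℕ∑.sum-cong-≗ λ i → cong 𝟙
        (trans (withNegatives-negative w (bs i) w<0) (sym (maximalZero-negative (as-maximal i) w<0)))))
  ... | no w≮0 = ×-monoˡ-≤ (ℚ.≮⇒≥ w≮0) (subst (_≤ count as l)
        (ℕ∑.sum-cong-≗ λ i → cong 𝟙 (sym (withNegatives-nonNegative w (bs i) w≮0)))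
        count-bs≤count-as)

  θ<wsum-withNegatives : Positive g → ∀ {x} → g x ≡ true → θ ℚ.< wsum w (withNegatives w x)
  θ<wsum-withNegatives positive {x} x-one = ℚ.≰⇒> λ ≤θ →
    contradiction (trans (sym x⁺-one) (Equivalence.from (threshold _) ≤θ)) λ ()
    where
      x⁺-one : g (withNegatives w x) ≡ true
      x⁺-one = positive x (withNegatives w x) x-one (≼-withNegatives w x)

module Cycle {n k m} (a b : Fin k → Point n) {c : Fin (3 + m) → Point n}
  (c-injective : Injective _≡_ _≡_ c) (edge : ∀ i → Adj a b (c i) (c (next i))) where

  label : Fin (3 + m) → Fin k
  label i = proj₁ (edge i)

  Edge : Fin (3 + m) → Set
  Edge i = Adj a b (c i) (c (next i))

  private
    no-antiparallel : ∀ {i i′} → c i ≡ c (next i′) → c (next i) ≡ c i′ → ⊥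
    no-antiparallel {i} {i′} p q = next∘next≢id i′ (trans (cong next (sym (c-injective p))) (c-injective q))

    same-label⇒same-position : ∀ {i i′} (e : Edge i) (e′ : Edge i′) → proj₁ e ≡ proj₁ e′ → i ≡ i′
    same-label⇒same-position (_ , inj₁ (ci≡a , _)) (_ , inj₁ (ci′≡a , _)) refl =
      c-injective (trans ci≡a (sym ci′≡a))
    same-label⇒same-position (_ , inj₂ (ci≡b , _)) (_ , inj₂ (ci′≡b , _)) refl =
      c-injective (trans ci≡b (sym ci′≡b))
    same-label⇒same-position (_ , inj₁ (ci≡a , ci⁺≡b)) (_ , inj₂ (ci′≡b , ci′⁺≡a)) refl =
      ⊥-elim (no-antiparallel (trans ci≡a (sym ci′⁺≡a)) (trans ci⁺≡b (sym ci′≡b)))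
    same-label⇒same-position (_ , inj₂ (ci≡b , ci⁺≡a)) (_ , inj₁ (ci′≡a , ci′⁺≡b)) refl =
      ⊥-elim (no-antiparallel (trans ci≡b (sym ci′⁺≡b)) (trans ci⁺≡a (sym ci′≡a)))

  label-injective : Injective _≡_ _≡_ label
  label-injective {i} {i′} = same-label⇒same-position (edge i) (edge i′)

  endpoints : (h : Point n → ℕ) → ∀ i → h (a (label i)) + h (b (label i)) ≡ h (c i) + h (c (next i))
  endpoints h i with edge i
  ... | _ , inj₁ (ci≡a , ci⁺≡b) = cong₂ _+_ (cong h (sym ci≡a)) (cong h (sym ci⁺≡b))
  ... | j , inj₂ (ci≡b , ci⁺≡a) =
    trans (ℕ.+-comm (h (a j)) (h (b j))) (cong₂ _+_ (cong h (sym ci≡b)) (cong h (sym ci⁺≡a)))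

  sum-endpoints : (h : Point n → ℕ) →
    ∑ℕ (λ i → h (a (label i)) + h (b (label i))) ≡ ∑ℕ (h ∘ c) + ∑ℕ (h ∘ c)
  sum-endpoints h = begin
    ∑ℕ (λ i → h (a (label i)) + h (b (label i))) ≡⟨ ℕ∑.sum-cong-≗ (endpoints h) ⟩
    ∑ℕ (λ i → h (c i) + h (c (next i)))         ≡⟨ ℕ∑.∑-distrib-+ (h ∘ c) (h ∘ c ∘ next) ⟩
    ∑ℕ (h ∘ c) + ∑ℕ (h ∘ c ∘ next)              ≡⟨ cong (∑ℕ (h ∘ c) +_)
                                                       (sum-next ℕ.+-0-commutativeMonoid (h ∘ c)) ⟩
    ∑ℕ (h ∘ c) + ∑ℕ (h ∘ c)                     ∎
    where open ≡-Reasoning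

  count-b≤count-a : (g : BoolFun n) → (∀ j → g (a j) ≡ false) → (∀ j → g (b j) ≡ true) →
    {idx : Fin k → Fin n} → Injective _≡_ _≡_ idx →
    ∀ l → (∀ j → l ≢ idx j → lookup (b j) l ≡ true → lookup (a j) l ≡ true) →
    count (b ∘ label) l ≤ count (a ∘ label) l
  count-b≤count-a g a-zero b-one {idx} idx-injective l b⇒a =
    subst₂ _≤_ (sym count-b) (sym count-a) (ℕ.+-mono-≤ ones≤zeros ones≤zeros)
    where
      one-with-l zero-with-l : Point n → ℕ
      one-with-l v = 𝟙 (g v ∧ lookup v l)
      zero-with-l v = 𝟙 (not (g v) ∧ lookup v l)

      ones zeros : ℕ
      ones = ∑ℕ (one-with-l ∘ c)
      zeros = ∑ℕ (zero-with-l ∘ c)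

      count-b : count (b ∘ label) l ≡ ones + ones
      count-b = trans (ℕ∑.sum-cong-≗ b-term) (sum-endpoints one-with-l)
        where
          b-term : ∀ i → 𝟙 (lookup (b (label i)) l) ≡ one-with-l (a (label i)) + one-with-l (b (label i))
          b-term i rewrite a-zero (label i) | b-one (label i) = refl

      count-a : count (a ∘ label) l ≡ zeros + zeros
      count-a = trans (ℕ∑.sum-cong-≗ a-term) (sum-endpoints zero-with-l)
        where
          a-term : ∀ i → 𝟙 (lookup (a (label i)) l) ≡ zero-with-l (a (label i)) + zero-with-l (b (label i))
          a-term i rewrite a-zero (label i) | b-one (label i) = sym (ℕ.+-identityʳ _)

      at-most-one-more : ∀ j → 𝟙 (lookup (b j) l) ≤ 𝟙 (lookup (a j) l) + 𝟙 (does (idx j ≟ l))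
      at-most-one-more j with idx j ≟ l
      ... | yes _ = ℕ.≤-trans (𝟙≤1 _) (ℕ.m≤n+m 1 _)
      ... | no idx≢l = ℕ.≤-trans (𝟙-mono (b⇒a j (≢-sym idx≢l))) (ℕ.m≤m+n _ 0)

      a-at-l idx-is-l : Fin (3 + m) → ℕ
      a-at-l i = 𝟙 (lookup (a (label i)) l)
      idx-is-l i = 𝟙 (does (idx (label i) ≟ l))

      idx-is-l≤1 : ∑ℕ idx-is-l ≤ 1
      idx-is-l≤1 = ∑𝟙-≟-≤1 (label-injective ∘ idx-injective) l

      ones≤zeros : ones ≤ zeros
      ones≤zeros = m+m≤1+n+n⇒m≤n (begin
        ones + ones                                         ≡⟨ count-b ⟨
        count (b ∘ label) l                                 ≤⟨ ∑ℕ-mono-≤ (at-most-one-more ∘ label) ⟩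
        ∑ℕ (λ i → a-at-l i + idx-is-l i)                    ≡⟨ ℕ∑.∑-distrib-+ a-at-l idx-is-l ⟩
        count (a ∘ label) l + ∑ℕ idx-is-l                   ≤⟨ ℕ.+-monoʳ-≤ _ idx-is-l≤1 ⟩
        count (a ∘ label) l + 1                             ≡⟨ ℕ.+-comm _ 1 ⟩
        suc (count (a ∘ label) l)                           ≡⟨ cong suc count-a ⟩
        suc (zeros + zeros)                                 ∎)
        where open ℕ.≤-Reasoning

lemma1 : (n : ℕ) (g : BoolFun n) → Positive g → Threshold g →
    (k : ℕ) (idx : Fin k → Fin n) → Injective _≡_ _≡_ idx →
    (∀ j → Relevant g (idx j)) →
    (a b : Fin k → Point n) → (∀ j → Extremal g (idx j) (a j) (b j)) →
    Acyclic a b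
lemma1 n g positive (w , θ , threshold) k idx idx-injective _ a b extremal m c c-injective steps closing =
  ℚ.<-irrefl refl (ℚ.<-≤-trans zeros<ones ones≤zeros)
  where
    open ThresholdFunction w θ threshold
    open Cycle a b c-injective (cyclically {R = Adj a b} {c = c} steps closing)

    a-maximal : ∀ j → MaximalZero g (a j)
    a-maximal j = proj₁ (extremal j)

    b-one : ∀ j → g (b j) ≡ true
    b-one j = proj₁ (proj₁ (proj₂ (proj₂ (extremal j))))

    b⇒a : ∀ j l → l ≢ idx j → lookup (b j) l ≡ true → lookup (a j) l ≡ true
    b⇒a j = proj₂ (proj₂ (proj₂ (proj₂ (extremal j))))

    zeros<ones : ∑ℚ (λ i → wsum w (a (label i))) ℚ.< ∑ℚ (λ i → wsum w (withNegatives w (b (label i))))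
    zeros<ones = ∑ℚ-mono-< λ i → ℚ.≤-<-trans (Equivalence.to (threshold _) (proj₁ (a-maximal (label i))))
                                              (θ<wsum-withNegatives positive (b-one (label i)))

    ones≤zeros : ∑ℚ (λ i → wsum w (withNegatives w (b (label i)))) ℚ.≤ ∑ℚ (λ i → wsum w (a (label i)))
    ones≤zeros = ∑-wsum-mono-≤ w {withNegatives w ∘ b ∘ label} {a ∘ label} λ l →
      count×-withNegatives≤ {bs = b ∘ label} (a-maximal ∘ label) l
        (count-b≤count-a g (proj₁ ∘ a-maximal) b-one idx-injective l (λ j → b⇒a j l))
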